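{- Let $P$ be a constraint logic program over a constraint theory $CT$, and let $C_1 \Rightarrow C_2$ be a general propagation rule, where $C_1$ and $C_2$ are finite sets of primitive and user-defined constraints. Let $\mathcal{V}$ be the set of variables occurring in $C_1$. Suppose the goal $C_1$ has a finite computation tree whose set of answers is $\{a_1,\ldots,a_n\}$, and the goal $C_1 \cup C_2$ has a finite computation tree whose set of answers is $\{b_1,\ldots,b_m\}$ (each answer being a conjunction of primitive constraints). Then the rule $C_1 \Rightarrow C_2$ is valid with respect to $CT$ and $P$ if $$P^*, CT \models \neg\Big(\exists_{ -\mathcal{V}}\big((a_1 \vee \cdots \vee a_n) \wedge \neg \exists_{ -\mathcal{V}}(b_1 \vee \cdots \vee b_m)\big)\Big).$$
   Context: Constraints are of two kinds: primitive constraints, whose meaning is given by a first-order constraint theory $CT$ (for which a solver is available), and user-defined constraints, defined by a constraint logic program. A constraint logic program $P$ is a finite set of clauses $h \leftarrow b_1,\ldots,b_n,c_1,\ldots,c_m$ where $h,b_1,\ldots,b_n$ are user-defined constraints (atoms) and $c_1,\ldots,c_m$ are primitive constraints. A goal is a set of primitive and user-defined constraints (read as their conjunction); an answer is a set (conjunction) of primitive constraints, obtained as a computed answer of standard CLP resolution of a goal with respect to $P$ and $CT$; "the set of answers" of a goal means all computed answers of its computation tree. $P^*$ denotes the Clark completion of $P$. For a formula $\phi$ and a set of variables $\mathcal{V}$, $\exists_{ -\mathcal{V}}(\phi)$ denotes the existential closure of $\phi$ over all its free variables except those in $\mathcal{V}$. A general propagation rule is a rule $C_1 \Rightarrow C_2$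 with $C_1, C_2$ sets of primitive and user-defined constraints; writing $C_1=\{d_1,\ldots,d_k\}$, $C_2=\{c_1,\ldots,c_l\}$, it is valid with respect to $CT$ and $P$ iff $P^*, CT \models \bigwedge_i d_i \rightarrow \exists_{ -\mathcal{V}}(\bigwedge_j c_j)$, where $\mathcal{V}$ is the set of variables of $C_1$. -}

module Defs where

open import Data.Nat using (ℕ; _≟_)
open import Data.List using (List; []; _∷_; _++_; foldr; filter; length; zipWith)
open import Data.List.Membership.Propositional using (_∈_; _∉_)
open import Data.List.Membership.DecPropositional _≟_ using (_∈?_)
open import Data.Product using (Σ; _×_; _,_)
open import Data.Sum using (_⊎_)
open import Data.Empty using (⊥)
open import Data.Unit using (⊤)
open import Relation.Nullary using (¬_; ¬?; yes; no)
open import Relation.Binary.PropositionalEquality using (_≡_)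
open import Function.Definitions using (Injective)
open import Function.Bundles using (_⇔_)

-- Syntax.  F : function symbols, Pr : primitive (CT) predicate symbols,
-- Q : user-defined predicate symbols.  Symbols are variadic (argument
-- lists); variables are natural numbers.

Var : Set
Var = ℕ

data Term (F : Set) : Set where
  var : Var → Term F
  fun : F → List (Term F) → Term F

data Prim (F Pr : Set) : Set where
  pc  : Pr → List (Term F) → Prim F Pr
  _≐_ : Term F → Term F → Prim F Pr

data Constraint (F Pr Q : Set) : Set where
  prim : Prim F Pr → Constraint F Pr Q
  user : Q → List (Term F) → Constraint F Pr Q

record Clause (F Pr Q : Set) : Set where
  constructor clause
  field
    hpred : Q
    hargs : List (Term F)
    body  : List (Constraint F Pr Q)
open Clause public

data Formula (F Pr Q : Set) : Set where
  ⊤ᶠ ⊥ᶠ : Formula F Pr Q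
  primᶠ : Prim F Pr → Formula F Pr Q
  userᶠ : Q → List (Term F) → Formula F Pr Q
  ¬ᶠ_   : Formula F Pr Q → Formula F Pr Q
  _∧ᶠ_  : Formula F Pr Q → Formula F Pr Q → Formula F Pr Q
  _∨ᶠ_  : Formula F Pr Q → Formula F Pr Q → Formula F Pr Q
  ∃ᶠ    : Var → Formula F Pr Q → Formula F Pr Q

infixr 6 _∧ᶠ_
infixr 5 _∨ᶠ_

module _ {F Pr Q : Set} where

  _⇒ᶠ_ : Formula F Pr Q → Formula F Pr Q → Formula F Pr Q
  A ⇒ᶠ B = ¬ᶠ (A ∧ᶠ ¬ᶠ B)

  toF : Constraint F Pr Q → Formula F Pr Q
  toF (prim c)    = primᶠ c
  toF (user q ts) = userᶠ q ts

  ⋀ : List (Constraint F Pr Q) → Formula F Pr Q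
  ⋀ = foldr (λ c φ → toF c ∧ᶠ φ) ⊤ᶠ

  ⋀ₚ : List (Prim F Pr) → Formula F Pr Q
  ⋀ₚ = foldr (λ c φ → primᶠ c ∧ᶠ φ) ⊤ᶠ

  ⋁ : List (List (Prim F Pr)) → Formula F Pr Q
  ⋁ = foldr (λ a φ → ⋀ₚ a ∨ᶠ φ) ⊥ᶠ

mutual
  varsT : {F : Set} → Term F → List Var
  varsT (var x)    = x ∷ []
  varsT (fun f ts) = varsTs ts

  varsTs : {F : Set} → List (Term F) → List Var
  varsTs []       = []
  varsTs (t ∷ ts) = varsT t ++ varsTs ts

varsP : {F Pr : Set} → Prim F Pr → List Var
varsP (pc p ts) = varsTs ts
varsP (s ≐ t)   = varsT s ++ varsT t

varsPs : {F Pr : Set} → List (Prim F Pr) → List Var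
varsPs []       = []
varsPs (c ∷ cs) = varsP c ++ varsPs cs

varsC : {F Pr Q : Set} → Constraint F Pr Q → List Var
varsC (prim c)    = varsP c
varsC (user q ts) = varsTs ts

varsCs : {F Pr Q : Set} → List (Constraint F Pr Q) → List Var
varsCs []       = []
varsCs (c ∷ cs) = varsC c ++ varsCs cs

varsClause : {F Pr Q : Set} → Clause F Pr Q → List Var
varsClause cl = varsTs (hargs cl) ++ varsCs (body cl)

fv : {F Pr Q : Set} → Formula F Pr Q → List Var
fv ⊤ᶠ = []
fv ⊥ᶠ = []
fv (primᶠ c) = varsP c
fv (userᶠ q ts) = varsTs ts
fv (¬ᶠ φ) = fv φ
fv (φ ∧ᶠ ψ) = fv φ ++ fv ψ
fv (φ ∨ᶠ ψ) = fv φ ++ fv ψ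
fv (∃ᶠ x φ) = filter (λ y → ¬? (x ≟ y)) (fv φ)

∃₋ : {F Pr Q : Set} → List Var → Formula F Pr Q → Formula F Pr Q
∃₋ V φ = foldr ∃ᶠ φ (filter (λ y → ¬? (y ∈? V)) (fv φ))

mutual
  renT : {F : Set} → (Var → Var) → Term F → Term F
  renT r (var x)    = var (r x)
  renT r (fun f ts) = fun f (renTs r ts)

  renTs : {F : Set} → (Var → Var) → List (Term F) → List (Term F)
  renTs r []       = []
  renTs r (t ∷ ts) = renT r t ∷ renTs r ts

renP : {F Pr : Set} → (Var → Var) → Prim F Pr → Prim F Pr
renP r (pc p ts) = pc p (renTs r ts)
renP r (s ≐ t)   = renT r s ≐ renT r t

renC : {F Pr Q : Set} → (Var → Var) → Constraint F Pr Q → Constraint F Pr Q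
renC r (prim c)    = prim (renP r c)
renC r (user q ts) = user q (renTs r ts)

renCs : {F Pr Q : Set} → (Var → Var) → List (Constraint F Pr Q) → List (Constraint F Pr Q)
renCs r []       = []
renCs r (c ∷ cs) = renC r c ∷ renCs r cs

-- Semantics (classical Tarskian semantics, rendered constructively via
-- double negation on atoms, ∨ and ∃)

record Structure (F Pr Q : Set) : Set₁ where
  field
    D     : Set
    funI  : F → List D → D
    primI : Pr → List D → Set
    userI : Q → List D → Set
open Structure public

¬¬_ : Set → Set
¬¬ A = ¬ ¬ A

module _ {F Pr Q : Set} (M : Structure F Pr Q) where

  Valuation : Set
  Valuation = Var → D M

  mutual
    eval : Valuation → Term F → D M
    eval ρ (var x)    = ρ x
    eval ρ (fun f ts) = funI M f (evals ρ ts)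

    evals : Valuation → List (Term F) → List (D M)
    evals ρ []       = []
    evals ρ (t ∷ ts) = eval ρ t ∷ evals ρ ts

  update : Valuation → Var → D M → Valuation
  update ρ x d y with x ≟ y
  ... | yes _ = d
  ... | no  _ = ρ y

  ⟦_⟧ : Formula F Pr Q → Valuation → Set
  ⟦ ⊤ᶠ ⟧ ρ = ⊤
  ⟦ ⊥ᶠ ⟧ ρ = ⊥
  ⟦ primᶠ (pc p ts) ⟧ ρ = ¬¬ primI M p (evals ρ ts)
  ⟦ primᶠ (s ≐ t) ⟧ ρ = ¬¬ (eval ρ s ≡ eval ρ t)
  ⟦ userᶠ q ts ⟧ ρ = ¬¬ userI M q (evals ρ ts)
  ⟦ ¬ᶠ φ ⟧ ρ = ¬ ⟦ φ ⟧ ρ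
  ⟦ φ ∧ᶠ ψ ⟧ ρ = ⟦ φ ⟧ ρ × ⟦ ψ ⟧ ρ
  ⟦ φ ∨ᶠ ψ ⟧ ρ = ¬¬ (⟦ φ ⟧ ρ ⊎ ⟦ ψ ⟧ ρ)
  ⟦ ∃ᶠ x φ ⟧ ρ = ¬¬ (Σ (D M) λ d → ⟦ φ ⟧ (update ρ x d))

module _ {F Pr Q : Set} where

  -- M is a model of the theory CT (a set of formulas, read as universal closures)
  ModelCT : (Formula F Pr Q → Set) → Structure F Pr Q → Set
  ModelCT CT M = ∀ φ → CT φ → ∀ ρ → ⟦ M ⟧ φ ρ

  -- M is a model of the Clark completion P* :
  --   ∀ x̄ ( q(x̄) ↔ ⋁_{q(t̄) ← B ∈ P} ∃ ȳ ( x̄ = t̄ ∧ B ) )   for every q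
  ModelComp : List (Clause F Pr Q) → Structure F Pr Q → Set
  ModelComp P M = ∀ (q : Q) (ds : List (D M)) →
    (¬¬ userI M q ds) ⇔
    ¬¬ (Σ (Clause F Pr Q) λ cl → cl ∈ P × hpred cl ≡ q ×
          Σ (Valuation M) λ σ → evals M σ (hargs cl) ≡ ds × ⟦ M ⟧ (⋀ (body cl)) σ)

  Entails : (Formula F Pr Q → Set) → List (Clause F Pr Q) → Formula F Pr Q → Set₁
  Entails CT P φ = ∀ (M : Structure F Pr Q) → ModelCT CT M → ModelComp P M →
                   ∀ (ρ : Valuation M) → ⟦ M ⟧ φ ρ

  Unsat : (Formula F Pr Q → Set) → List (Prim F Pr) → Set₁
  Unsat CT S = ∀ (M : Structure F Pr Q) → ModelCT CT M →
               ∀ (ρ : Valuation M) → ¬ ⟦ M ⟧ (⋀ₚ S) ρ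

  ValidRule : (Formula F Pr Q → Set) → List (Clause F Pr Q) →
              List (Constraint F Pr Q) → List (Constraint F Pr Q) → Set₁
  ValidRule CT P C₁ C₂ = Entails CT P (⋀ C₁ ⇒ᶠ ∃₋ (varsCs C₁) (⋀ C₂))

-- A state is ⟨G , S⟩ with G the goal (list of
-- constraints still to be processed) and S the constraint store (list of
-- primitive constraints).  Tree CT P G S as : a finite computation tree
-- for ⟨G , S⟩ whose answers (stores of success leaves, left to right)
-- are the list as.  The selected constraint may be chosen arbitrarily at
-- each node (arbitrary selection); an atom is resolved with a variant of
-- every clause of P (renamed apart from the current state); a node may be
-- a failure leaf when its store is unsatisfiable in CT.

module _ {F Pr Q : Set} (CT : Formula F Pr Q → Set) (P : List (Clause F Pr Q)) where

  varsState : List (Constraint F Pr Q) → List (Prim F Pr) → List Var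
  varsState G S = varsCs G ++ varsPs S

  mutual
    data Tree : List (Constraint F Pr Q) → List (Prim F Pr) →
                List (List (Prim F Pr)) → Set₁ where
      success : ∀ {S} → Tree [] S (S ∷ [])
      failure : ∀ {G S} → Unsat CT S → Tree G S []
      solve   : ∀ {G₁ G₂ c S as} →
                Tree (G₁ ++ G₂) (c ∷ S) as →
                Tree (G₁ ++ prim c ∷ G₂) S as
      unfold  : ∀ {G₁ G₂ q ss S as} →
                Branches G₁ G₂ q ss S P as →
                Tree (G₁ ++ user q ss ∷ G₂) S as

    data Branches (G₁ G₂ : List (Constraint F Pr Q)) (q : Q) (ss : List (Term F))
                  (S : List (Prim F Pr)) :
                  List (Clause F Pr Q) → List (List (Prim F Pr)) → Set₁ where
      done : Branches G₁ G₂ q ss S [] []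
      skip : ∀ {cl cls as} →
             ¬ (hpred cl ≡ q × length (hargs cl) ≡ length ss) →
             Branches G₁ G₂ q ss S cls as →
             Branches G₁ G₂ q ss S (cl ∷ cls) as
      step : ∀ {cl cls a as} (r : Var → Var) →
             Injective _≡_ _≡_ r →
             (∀ x → x ∈ varsClause cl → r x ∉ varsState (G₁ ++ user q ss ∷ G₂) S) →
             hpred cl ≡ q →
             length (hargs cl) ≡ length ss →
             Tree (G₁ ++ renCs r (body cl) ++ G₂)
                  (zipWith _≐_ ss (renTs r (hargs cl)) ++ S) a →
             Branches G₁ G₂ q ss S cls as →
             Branches G₁ G₂ q ss S (cl ∷ cls) (a ++ as)

{-# OPTIONS --safe #-}
module Submission where

-- Work in a model M of CT and P*, reading a state ⟨G , S⟩ as the formula G ∧ S. A finite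
-- computation tree relates a state to its answers in both directions, up to changing a
-- valuation outside the variables of the state: a valuation satisfying the state can be so
-- changed to satisfy some answer (at an unfolding the completion yields a satisfied clause
-- instance, and as the variant is renamed apart the valuation extends to its variables), and
-- a valuation satisfying an answer can be so changed to satisfy the state. If ρ satisfies C₁
-- but no valuation agreeing with ρ on V satisfies C₂, the first direction gives such a ρ′
-- satisfying some aᵢ, and the second shows that ρ′ falsifies ∃₋V(b₁ ∨ ⋯ ∨ bₘ), for otherwise
-- some valuation agreeing with ρ on V would satisfy C₁ ∧ C₂. So ρ′ satisfies the formula the
-- hypothesis declares unsatisfiable. As ∨ and ∃ are interpreted by double negation, the
-- argument runs in the ¬¬ monad.

open import Defs
open import Data.Nat using (suc; _≟_)
open import Data.Nat.Properties using (suc-injective)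
open import Data.List using (List; []; _∷_; _++_; foldr; filter; length; zipWith)
open import Data.List.Properties using (++-assoc; ∷-injectiveˡ; ∷-injectiveʳ)
open import Data.List.Membership.Propositional using (_∈_; _∉_)
open import Data.List.Membership.DecPropositional _≟_ using (_∈?_)
open import Data.List.Membership.Propositional.Properties
  using (∈-++⁺ˡ; ∈-++⁺ʳ; ∈-++⁻; ∈-filter⁺; ∈-filter⁻)
open import Data.List.Relation.Binary.Subset.Propositional using (_⊆_)
open import Data.List.Relation.Binary.Subset.Propositional.Properties
  using (⊆-reflexive; xs⊆xs++ys; xs⊆ys++xs)
open import Data.List.Relation.Unary.Any using (Any; here; there)
open import Data.List.Relation.Unary.Any.Properties using (++⁺ˡ; ++⁺ʳ; ++⁻)
open import Data.Product using (Σ; _×_; _,_; proj₁; proj₂)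
open import Data.Sum using (inj₁; inj₂; [_,_])
open import Data.Empty using (⊥-elim)
open import Data.Unit using (tt)
open import Effect.Monad using (RawMonad)
open import Function using (_∘_; id)
open import Function.Bundles using (Equivalence)
open import Function.Definitions using (Injective)
open import Level using (0ℓ)
open import Relation.Nullary using (¬_; ¬?; yes; no)
open import Relation.Nullary.Negation using (¬¬-Monad; ¬¬-map)
open import Relation.Binary.PropositionalEquality
  using (_≡_; _≢_; refl; sym; trans; cong; cong₂; subst; subst₂; module ≡-Reasoning)

open RawMonad (¬¬-Monad {0ℓ}) using (pure; _>>=_)

length-renTs : ∀ {F} r (ts : List (Term F)) → length (renTs r ts) ≡ length ts
length-renTs r []       = refl
length-renTs r (t ∷ ts) = cong suc (length-renTs r ts)

module _ {F Pr : Set} where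

  varsPs-++ : (S₁ S₂ : List (Prim F Pr)) → varsPs (S₁ ++ S₂) ≡ varsPs S₁ ++ varsPs S₂
  varsPs-++ []       S₂ = refl
  varsPs-++ (c ∷ S₁) S₂ = trans (cong (varsP c ++_) (varsPs-++ S₁ S₂)) (sym (++-assoc (varsP c) _ _))

  varsTs⊆varsPs-zip≐ : (ss ts : List (Term F)) → length ss ≡ length ts →
                       varsTs ss ⊆ varsPs {Pr = Pr} (zipWith _≐_ ss ts)
  varsTs⊆varsPs-zip≐ (s ∷ ss) (t ∷ ts) |ss|≡|ts| y∈ with ∈-++⁻ (varsT s) y∈
  ... | inj₁ y∈s  = ∈-++⁺ˡ (∈-++⁺ˡ y∈s)
  ... | inj₂ y∈ss = ∈-++⁺ʳ (varsT s ++ varsT t) (varsTs⊆varsPs-zip≐ ss ts (suc-injective |ss|≡|ts|) y∈ss)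

module _ {F Pr Q : Set} where

  State : List (Constraint F Pr Q) → List (Prim F Pr) → Formula F Pr Q
  State G S = ⋀ G ∧ᶠ ⋀ₚ S

  resolventGoal : (Var → Var) → Clause F Pr Q →
                  List (Constraint F Pr Q) → List (Constraint F Pr Q) → List (Constraint F Pr Q)
  resolventGoal r cl G₁ G₂ = G₁ ++ renCs r (body cl) ++ G₂

  resolventStore : (Var → Var) → Clause F Pr Q → List (Term F) → List (Prim F Pr) → List (Prim F Pr)
  resolventStore r cl ss S = zipWith _≐_ ss (renTs r (hargs cl)) ++ S

  varsCs-++ : (G₁ G₂ : List (Constraint F Pr Q)) → varsCs (G₁ ++ G₂) ≡ varsCs G₁ ++ varsCs G₂
  varsCs-++ []       G₂ = refl
  varsCs-++ (c ∷ G₁) G₂ = trans (cong (varsC c ++_) (varsCs-++ G₁ G₂)) (sym (++-assoc (varsC c) _ _))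

  varsC⊆varsCs-selected : ∀ G₁ G₂ (c : Constraint F Pr Q) → varsC c ⊆ varsCs (G₁ ++ c ∷ G₂)
  varsC⊆varsCs-selected G₁ G₂ c y∈ =
    subst (_ ∈_) (sym (varsCs-++ G₁ (c ∷ G₂))) (∈-++⁺ʳ (varsCs G₁) (∈-++⁺ˡ y∈))

  fv-⋀ : (G : List (Constraint F Pr Q)) → fv (⋀ G) ≡ varsCs G
  fv-⋀ []               = refl
  fv-⋀ (prim c ∷ G)     = cong (varsP c ++_) (fv-⋀ G)
  fv-⋀ (user q ts ∷ G)  = cong (varsTs ts ++_) (fv-⋀ G)

  fv-⋀ₚ : (S : List (Prim F Pr)) → fv (⋀ₚ {Q = Q} S) ≡ varsPs S
  fv-⋀ₚ []      = refl
  fv-⋀ₚ (c ∷ S) = cong (varsP c ++_) (fv-⋀ₚ S)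

  fv-State : (G : List (Constraint F Pr Q)) (S : List (Prim F Pr)) → fv (State G S) ≡ varsCs G ++ varsPs S
  fv-State G S = cong₂ _++_ (fv-⋀ G) (fv-⋀ₚ S)

  varsState-replace : ∀ G₁ G₂ (c : Constraint F Pr Q) B (E S : List (Prim F Pr)) →
    varsC c ⊆ varsCs B ++ varsPs E →
    varsCs (G₁ ++ c ∷ G₂) ++ varsPs S ⊆ varsCs (G₁ ++ B ++ G₂) ++ varsPs (E ++ S)
  varsState-replace G₁ G₂ c B E S c⊆ y∈
    rewrite varsCs-++ G₁ (c ∷ G₂) | varsCs-++ G₁ (B ++ G₂) | varsCs-++ B G₂ | varsPs-++ E S
    with ∈-++⁻ (varsCs G₁ ++ varsC c ++ varsCs G₂) y∈
  ... | inj₂ y∈S = ∈-++⁺ʳ (varsCs G₁ ++ varsCs B ++ varsCs G₂) (∈-++⁺ʳ (varsPs E) y∈S)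
  ... | inj₁ y∈G with ∈-++⁻ (varsCs G₁) y∈G
  ... | inj₁ y∈G₁ = ∈-++⁺ˡ (∈-++⁺ˡ y∈G₁)
  ... | inj₂ y∈cG₂ with ∈-++⁻ (varsC c) y∈cG₂
  ... | inj₂ y∈G₂ = ∈-++⁺ˡ (∈-++⁺ʳ (varsCs G₁) (∈-++⁺ʳ (varsCs B) y∈G₂))
  ... | inj₁ y∈c with ∈-++⁻ (varsCs B) (c⊆ y∈c)
  ... | inj₁ y∈B = ∈-++⁺ˡ (∈-++⁺ʳ (varsCs G₁) (∈-++⁺ˡ y∈B))
  ... | inj₂ y∈E = ∈-++⁺ʳ (varsCs G₁ ++ varsCs B ++ varsCs G₂) (∈-++⁺ˡ y∈E)

  varsState-solve : (G₁ G₂ : List (Constraint F Pr Q)) (c : Prim F Pr) (S : List (Prim F Pr)) →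
    varsCs (G₁ ++ prim c ∷ G₂) ++ varsPs S ⊆ varsCs (G₁ ++ G₂) ++ varsPs (c ∷ S)
  varsState-solve G₁ G₂ c S = varsState-replace G₁ G₂ (prim c) [] (c ∷ []) S (xs⊆xs++ys (varsP c) [])

  varsState-unfold : ∀ (G₁ G₂ : List (Constraint F Pr Q)) q ss (S : List (Prim F Pr)) r cl →
    length (hargs cl) ≡ length ss →
    varsCs (G₁ ++ user q ss ∷ G₂) ++ varsPs S ⊆
    varsCs (resolventGoal r cl G₁ G₂) ++ varsPs (resolventStore r cl ss S)
  varsState-unfold G₁ G₂ q ss S r cl |hargs|≡|ss| =
    varsState-replace G₁ G₂ (user q ss) (renCs r (body cl)) (zipWith _≐_ ss (renTs r (hargs cl))) S
      (∈-++⁺ʳ (varsCs (renCs r (body cl))) ∘ varsTs⊆varsPs-zip≐ ss (renTs r (hargs cl)) |ss|≡|renamed-hargs|)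
    where
    |ss|≡|renamed-hargs| = trans (sym |hargs|≡|ss|) (sym (length-renTs r (hargs cl)))

module Semantics {F Pr Q : Set} (M : Structure F Pr Q) where

  ⟦_⟧ₚ : List (Prim F Pr) → Valuation M → Set
  ⟦ S ⟧ₚ = ⟦ M ⟧ (⋀ₚ {Q = Q} S)

  Agree : List Var → Valuation M → Valuation M → Set
  Agree W ρ σ = ∀ {y} → y ∈ W → ρ y ≡ σ y

  ∃Agree : List Var → Valuation M → (Valuation M → Set) → Set
  ∃Agree W ρ P = ¬¬ Σ (Valuation M) λ σ → Agree W ρ σ × P σ

  ∃Agree-intro : ∀ {W ρ σ} {P : Valuation M → Set} → Agree W ρ σ → P σ → ∃Agree W ρ P
  ∃Agree-intro {σ = σ} ρ≈σ hσ = pure (σ , (λ {_} → ρ≈σ) , hσ)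

  ∃Agree-map : ∀ {W W′ ρ} {P P′ : Valuation M → Set} →
               W ⊆ W′ → (∀ {σ} → P σ → P′ σ) → ∃Agree W′ ρ P → ∃Agree W ρ P′
  ∃Agree-map W⊆W′ P⇒P′ = ¬¬-map λ (σ , ρ≈σ , hP) → σ , ρ≈σ ∘ W⊆W′ , P⇒P′ hP

  ∃Agree-bind : ∀ {W W′ ρ} {R P : Valuation M → Set} →
                W ⊆ W′ → ∃Agree W ρ R → (∀ {σ} → R σ → ∃Agree W′ σ P) → ∃Agree W ρ P
  ∃Agree-bind W⊆W′ hR k = do
    (σ , ρ≈σ , hσ) ← hR
    (τ , σ≈τ , hτ) ← k hσ
    ∃Agree-intro (λ y∈ → trans (ρ≈σ y∈) (σ≈τ (W⊆W′ y∈))) hτ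

  mutual
    eval-agree : ∀ {ρ σ} (t : Term F) → Agree (varsT t) ρ σ → eval M ρ t ≡ eval M σ t
    eval-agree (var x)    ρ≈σ = ρ≈σ (here refl)
    eval-agree (fun f ts) ρ≈σ = cong (funI M f) (evals-agree ts ρ≈σ)

    evals-agree : ∀ {ρ σ} (ts : List (Term F)) → Agree (varsTs ts) ρ σ → evals M ρ ts ≡ evals M σ ts
    evals-agree []       ρ≈σ = refl
    evals-agree (t ∷ ts) ρ≈σ =
      cong₂ _∷_ (eval-agree t (ρ≈σ ∘ ∈-++⁺ˡ)) (evals-agree ts (ρ≈σ ∘ ∈-++⁺ʳ (varsT t)))

  mutual
    eval-ren : ∀ {τ} r (t : Term F) → eval M τ (renT r t) ≡ eval M (τ ∘ r) t
    eval-ren r (var x)    = refl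
    eval-ren r (fun f ts) = cong (funI M f) (evals-ren r ts)

    evals-ren : ∀ {τ} r (ts : List (Term F)) → evals M τ (renTs r ts) ≡ evals M (τ ∘ r) ts
    evals-ren r []       = refl
    evals-ren r (t ∷ ts) = cong₂ _∷_ (eval-ren r t) (evals-ren r ts)

  length-evals : ∀ {ρ} (ts : List (Term F)) → length (evals M ρ ts) ≡ length ts
  length-evals []       = refl
  length-evals (t ∷ ts) = cong suc (length-evals ts)

  evals-≡⇒length-≡ : ∀ {ρ σ} (ts us : List (Term F)) → evals M ρ ts ≡ evals M σ us → length ts ≡ length us
  evals-≡⇒length-≡ ts us eq = trans (sym (length-evals ts)) (trans (cong length eq) (length-evals us))

  update-other : ∀ {ρ x d y} → x ≢ y → update M ρ x d y ≡ ρ y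
  update-other {x = x} {y = y} x≢y with x ≟ y
  ... | yes x≡y = ⊥-elim (x≢y x≡y)
  ... | no _    = refl

  ⟦⟧-agree : ∀ (φ : Formula F Pr Q) {ρ σ} → Agree (fv φ) ρ σ → ⟦ M ⟧ φ ρ → ⟦ M ⟧ φ σ
  ⟦⟧-agree ⊤ᶠ _ = id
  ⟦⟧-agree ⊥ᶠ _ = id
  ⟦⟧-agree (primᶠ (pc p ts)) ρ≈σ = subst (λ ds → ¬¬ primI M p ds) (evals-agree ts ρ≈σ)
  ⟦⟧-agree (primᶠ (s ≐ t)) ρ≈σ =
    subst₂ (λ a b → ¬¬ (a ≡ b)) (eval-agree s (ρ≈σ ∘ ∈-++⁺ˡ)) (eval-agree t (ρ≈σ ∘ ∈-++⁺ʳ (varsT s)))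
  ⟦⟧-agree (userᶠ q ts) ρ≈σ = subst (λ ds → ¬¬ userI M q ds) (evals-agree ts ρ≈σ)
  ⟦⟧-agree (¬ᶠ φ) ρ≈σ ¬φ = ¬φ ∘ ⟦⟧-agree φ (sym ∘ ρ≈σ)
  ⟦⟧-agree (φ ∧ᶠ ψ) ρ≈σ (hφ , hψ) =
    ⟦⟧-agree φ (ρ≈σ ∘ ∈-++⁺ˡ) hφ , ⟦⟧-agree ψ (ρ≈σ ∘ ∈-++⁺ʳ (fv φ)) hψ
  ⟦⟧-agree (φ ∨ᶠ ψ) ρ≈σ =
    ¬¬-map [ inj₁ ∘ ⟦⟧-agree φ (ρ≈σ ∘ ∈-++⁺ˡ) , inj₂ ∘ ⟦⟧-agree ψ (ρ≈σ ∘ ∈-++⁺ʳ (fv φ)) ]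
  ⟦⟧-agree (∃ᶠ x φ) {ρ} {σ} ρ≈σ = ¬¬-map λ (d , hφ) → d , ⟦⟧-agree φ (agree d) hφ
    where
    agree : ∀ d → Agree (fv φ) (update M ρ x d) (update M σ x d)
    agree d {y} y∈ with x ≟ y
    ... | yes _   = refl
    ... | no x≢y = ρ≈σ (∈-filter⁺ (λ y → ¬? (x ≟ y)) y∈ x≢y)

  State-agree : ∀ G S {ρ σ} → Agree (varsCs G ++ varsPs S) ρ σ → ⟦ M ⟧ (State G S) ρ → ⟦ M ⟧ (State G S) σ
  State-agree G S ρ≈σ = ⟦⟧-agree (State G S) (ρ≈σ ∘ ⊆-reflexive (fv-State G S))

  ⋀-agree : ∀ G {ρ σ} → Agree (varsCs G) ρ σ → ⟦ M ⟧ (⋀ G) ρ → ⟦ M ⟧ (⋀ G) σ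
  ⋀-agree G ρ≈σ = ⟦⟧-agree (⋀ G) (ρ≈σ ∘ ⊆-reflexive (fv-⋀ G))

  module _ {A : Set} (f : A → Formula F Pr Q) where

    private
      Conj : List A → Formula F Pr Q
      Conj = foldr (λ x φ → f x ∧ᶠ φ) ⊤ᶠ

    Conj-++⁻ : ∀ xs {ys ρ} → ⟦ M ⟧ (Conj (xs ++ ys)) ρ → ⟦ M ⟧ (Conj xs) ρ × ⟦ M ⟧ (Conj ys) ρ
    Conj-++⁻ []       h          = tt , h
    Conj-++⁻ (x ∷ xs) (hx , hxs) = let (h₁ , h₂) = Conj-++⁻ xs hxs in (hx , h₁) , h₂

    Conj-++⁺ : ∀ xs {ys ρ} → ⟦ M ⟧ (Conj xs) ρ → ⟦ M ⟧ (Conj ys) ρ → ⟦ M ⟧ (Conj (xs ++ ys)) ρ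
    Conj-++⁺ []       _          h = h
    Conj-++⁺ (x ∷ xs) (hx , hxs) h = hx , Conj-++⁺ xs hxs h

  ⋀-++⁻ : ∀ G₁ {G₂ ρ} → ⟦ M ⟧ (⋀ (G₁ ++ G₂)) ρ → ⟦ M ⟧ (⋀ G₁) ρ × ⟦ M ⟧ (⋀ G₂) ρ
  ⋀-++⁻ = Conj-++⁻ toF

  ⋀-++⁺ : ∀ G₁ {G₂ ρ} → ⟦ M ⟧ (⋀ G₁) ρ → ⟦ M ⟧ (⋀ G₂) ρ → ⟦ M ⟧ (⋀ (G₁ ++ G₂)) ρ
  ⋀-++⁺ = Conj-++⁺ toF

  ⋀ₚ-++⁻ : ∀ S₁ {S₂ ρ} → ⟦ S₁ ++ S₂ ⟧ₚ ρ → ⟦ S₁ ⟧ₚ ρ × ⟦ S₂ ⟧ₚ ρ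
  ⋀ₚ-++⁻ = Conj-++⁻ primᶠ

  ⋀ₚ-++⁺ : ∀ S₁ {S₂ ρ} → ⟦ S₁ ⟧ₚ ρ → ⟦ S₂ ⟧ₚ ρ → ⟦ S₁ ++ S₂ ⟧ₚ ρ
  ⋀ₚ-++⁺ = Conj-++⁺ primᶠ

  ⋀-ren : ∀ r (G : List (Constraint F Pr Q)) τ → ⟦ M ⟧ (⋀ (renCs r G)) τ ≡ ⟦ M ⟧ (⋀ G) (τ ∘ r)
  ⋀-ren r []                     τ = refl
  ⋀-ren r (prim (pc p ts) ∷ G) τ = cong₂ _×_ (cong (λ ds → ¬¬ primI M p ds) (evals-ren r ts)) (⋀-ren r G τ)
  ⋀-ren r (prim (s ≐ t) ∷ G)   τ =
    cong₂ _×_ (cong₂ (λ a b → ¬¬ (a ≡ b)) (eval-ren r s) (eval-ren r t)) (⋀-ren r G τ)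
  ⋀-ren r (user q ts ∷ G)      τ = cong₂ _×_ (cong (λ ds → ¬¬ userI M q ds) (evals-ren r ts)) (⋀-ren r G τ)

  ⋀≐-intro : ∀ ss ts {ρ} → evals M ρ ss ≡ evals M ρ ts → ⟦ zipWith _≐_ ss ts ⟧ₚ ρ
  ⋀≐-intro []       _        _  = tt
  ⋀≐-intro (_ ∷ _)  []       _  = tt
  ⋀≐-intro (s ∷ ss) (t ∷ ts) eq = pure (∷-injectiveˡ eq) , ⋀≐-intro ss ts (∷-injectiveʳ eq)

  ⋀≐-elim : ∀ ss ts {ρ} → length ss ≡ length ts → ⟦ zipWith _≐_ ss ts ⟧ₚ ρ →
            ¬¬ (evals M ρ ss ≡ evals M ρ ts)
  ⋀≐-elim []       []       _         _          = pure refl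
  ⋀≐-elim (s ∷ ss) (t ∷ ts) |ss|≡|ts| (s≐t , h) = do
    s≡t   ← s≐t
    ss≡ts ← ⋀≐-elim ss ts (suc-injective |ss|≡|ts|) h
    pure (cong₂ _∷_ s≡t ss≡ts)

  AnyAnswer : List (List (Prim F Pr)) → Valuation M → Set
  AnyAnswer as ρ = Any (λ a → ⟦ a ⟧ₚ ρ) as

  ⋁-intro : ∀ {as ρ} → AnyAnswer as ρ → ⟦ M ⟧ (⋁ as) ρ
  ⋁-intro (here ha)  = pure (inj₁ ha)
  ⋁-intro (there ha) = pure (inj₂ (⋁-intro ha))

  ⋁-elim : ∀ as {ρ} → ⟦ M ⟧ (⋁ as) ρ → ¬¬ AnyAnswer as ρ
  ⋁-elim []       ()
  ⋁-elim (a ∷ as) h = h >>= [ pure ∘ here , ¬¬-map there ∘ ⋁-elim as ]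

  ∃ᶠ*-elim : ∀ xs φ {ρ} → ⟦ M ⟧ (foldr ∃ᶠ φ xs) ρ →
             ¬¬ Σ (Valuation M) λ σ → (∀ {y} → y ∉ xs → ρ y ≡ σ y) × ⟦ M ⟧ φ σ
  ∃ᶠ*-elim []       φ h = pure (_ , (λ {_} _ → refl) , h)
  ∃ᶠ*-elim (x ∷ xs) φ h = do
    (d , hd) ← h
    (σ , ρ[x↦d]≈σ , hσ) ← ∃ᶠ*-elim xs φ hd
    pure (σ , (λ {_} y∉ → trans (sym (update-other (y∉ ∘ here ∘ sym))) (ρ[x↦d]≈σ (y∉ ∘ there))) , hσ)

  ∃ᶠ*-intro : ∀ xs φ {ρ σ} → (∀ {y} → y ∈ fv φ → y ∉ xs → ρ y ≡ σ y) → ⟦ M ⟧ φ σ → ⟦ M ⟧ (foldr ∃ᶠ φ xs) ρ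
  ∃ᶠ*-intro []       φ ρ≈σ = ⟦⟧-agree φ (λ y∈ → sym (ρ≈σ y∈ λ ()))
  ∃ᶠ*-intro (x ∷ xs) φ {ρ} {σ} ρ≈σ hσ = pure (σ x , ∃ᶠ*-intro xs φ agree hσ)
    where
    agree : ∀ {y} → y ∈ fv φ → y ∉ xs → update M ρ x (σ x) y ≡ σ y
    agree {y} y∈ y∉ with x ≟ y
    ... | yes refl = refl
    ... | no x≢y  = ρ≈σ y∈ λ { (here y≡x) → x≢y (sym y≡x) ; (there y∈xs) → y∉ y∈xs }

  ∃₋-elim : ∀ V φ {ρ} → ⟦ M ⟧ (∃₋ V φ) ρ → ∃Agree V ρ (⟦ M ⟧ φ)
  ∃₋-elim V φ h = ∃ᶠ*-elim _ φ h >>= λ (_ , ρ≈σ , hσ) → ∃Agree-intro (ρ≈σ ∘ ∈V⇒free) hσ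
    where
    ∈V⇒free : ∀ {y} → y ∈ V → y ∉ filter (λ y → ¬? (y ∈? V)) (fv φ)
    ∈V⇒free y∈V y∈ = proj₂ (∈-filter⁻ (λ y → ¬? (y ∈? V)) {xs = fv φ} y∈) y∈V

  ∃₋-intro : ∀ V φ {ρ σ} → Agree V ρ σ → ⟦ M ⟧ φ σ → ⟦ M ⟧ (∃₋ V φ) ρ
  ∃₋-intro V φ {ρ} {σ} ρ≈σ = ∃ᶠ*-intro _ φ agree
    where
    agree : ∀ {y} → y ∈ fv φ → y ∉ filter (λ y → ¬? (y ∈? V)) (fv φ) → ρ y ≡ σ y
    agree {y} y∈ y∉ with y ∈? V
    ... | yes y∈V = ρ≈σ y∈V
    ... | no  y∉V = ⊥-elim (y∉ (∈-filter⁺ (λ y → ¬? (y ∈? V)) y∈ y∉V))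

  extend : (Var → Var) → Valuation M → Valuation M → List Var → Valuation M
  extend r σ ρ []       = ρ
  extend r σ ρ (x ∷ xs) = update M (extend r σ ρ xs) (r x) (σ x)

  extend-image : ∀ {r σ ρ} xs {x} → Injective _≡_ _≡_ r → x ∈ xs → extend r σ ρ xs (r x) ≡ σ x
  extend-image {r} {σ} (x₀ ∷ xs) {x} r-inj x∈ with r x₀ ≟ r x | x∈
  ... | yes rx₀≡rx | _           = cong σ (r-inj rx₀≡rx)
  ... | no rx₀≢rx  | here refl   = ⊥-elim (rx₀≢rx refl)
  ... | no _       | there x∈xs  = extend-image xs r-inj x∈xs

  extend-outside : ∀ {r σ ρ} xs {y} → (∀ {x} → x ∈ xs → r x ≢ y) → extend r σ ρ xs y ≡ ρ y
  extend-outside []                _      = refl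
  extend-outside {r} (x ∷ xs) {y} y∉r[xs] with r x ≟ y
  ... | yes rx≡y = ⊥-elim (y∉r[xs] (here refl) rx≡y)
  ... | no _     = extend-outside xs (y∉r[xs] ∘ there)

  -- With cls = P this is, definitionally, the right-hand side of the completion in ModelComp.
  ClauseInstance : List (Clause F Pr Q) → Q → List (D M) → Set
  ClauseInstance cls q ds = Σ (Clause F Pr Q) λ cl → cl ∈ cls × hpred cl ≡ q ×
                              Σ (Valuation M) λ σ → evals M σ (hargs cl) ≡ ds × ⟦ M ⟧ (⋀ (body cl)) σ

module Computation {F Pr Q : Set} (CT : Formula F Pr Q → Set) (P : List (Clause F Pr Q))
                   (M : Structure F Pr Q) (M⊨CT : ModelCT CT M) (M⊨P* : ModelComp P M) where
  open Semantics M

  goal⇒∃resolvent : ∀ {G₁ G₂ q ss S cl} r → Injective _≡_ _≡_ r →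
    (∀ x → x ∈ varsClause cl → r x ∉ varsState CT P (G₁ ++ user q ss ∷ G₂) S) →
    ∀ {ρ σ} → ⟦ M ⟧ (State (G₁ ++ user q ss ∷ G₂) S) ρ →
    evals M σ (hargs cl) ≡ evals M ρ ss → ⟦ M ⟧ (⋀ (body cl)) σ →
    ∃Agree (varsState CT P (G₁ ++ user q ss ∷ G₂) S) ρ
           (⟦ M ⟧ (State (resolventGoal r cl G₁ G₂) (resolventStore r cl ss S)))
  goal⇒∃resolvent {G₁} {G₂} {q} {ss} {S} {cl} r r-inj fresh {ρ} {σ} hGoal σ⊨head σ⊨body =
    ∃Agree-intro ρ≈ρ₁ (resolvent-holds (State-agree (G₁ ++ user q ss ∷ G₂) S ρ≈ρ₁ hGoal))
    where
    open ≡-Reasoning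
    W = varsState CT P (G₁ ++ user q ss ∷ G₂) S
    ρ₁ = extend r σ ρ (varsClause cl)

    ρ≈ρ₁ : Agree W ρ ρ₁
    ρ≈ρ₁ y∈W = sym (extend-outside (varsClause cl) λ x∈ rx≡y →
                      fresh _ x∈ (subst (_∈ W) (sym rx≡y) y∈W))

    σ≈ρ₁∘r : Agree (varsClause cl) σ (ρ₁ ∘ r)
    σ≈ρ₁∘r x∈ = sym (extend-image (varsClause cl) r-inj x∈)

    ss⊆W : varsTs ss ⊆ W
    ss⊆W = xs⊆xs++ys _ _ ∘ varsC⊆varsCs-selected G₁ G₂ (user q ss)

    head-equations : evals M ρ₁ ss ≡ evals M ρ₁ (renTs r (hargs cl))
    head-equations = begin
      evals M ρ₁ ss                     ≡⟨ evals-agree ss (ρ≈ρ₁ ∘ ss⊆W) ⟨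
      evals M ρ ss                      ≡⟨ σ⊨head ⟨
      evals M σ (hargs cl)              ≡⟨ evals-agree (hargs cl) (σ≈ρ₁∘r ∘ xs⊆xs++ys _ _) ⟩
      evals M (ρ₁ ∘ r) (hargs cl)       ≡⟨ evals-ren r (hargs cl) ⟨
      evals M ρ₁ (renTs r (hargs cl))   ∎

    renamed-body : ⟦ M ⟧ (⋀ (renCs r (body cl))) ρ₁
    renamed-body = subst id (sym (⋀-ren r (body cl) ρ₁))
                            (⋀-agree (body cl) (σ≈ρ₁∘r ∘ xs⊆ys++xs _ (varsTs (hargs cl))) σ⊨body)

    resolvent-holds : ⟦ M ⟧ (State (G₁ ++ user q ss ∷ G₂) S) ρ₁ →
                      ⟦ M ⟧ (State (resolventGoal r cl G₁ G₂) (resolventStore r cl ss S)) ρ₁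
    resolvent-holds (hG , hS) =
      let (h₁ , _ , h₂) = ⋀-++⁻ G₁ hG in
      ⋀-++⁺ G₁ h₁ (⋀-++⁺ (renCs r (body cl)) renamed-body h₂) ,
      ⋀ₚ-++⁺ (zipWith _≐_ ss (renTs r (hargs cl))) (⋀≐-intro ss _ head-equations) hS

  resolvent⇒goal : ∀ {G₁ G₂ q ss S cl} r → cl ∈ P → hpred cl ≡ q → length (hargs cl) ≡ length ss →
    ∀ {τ} → ⟦ M ⟧ (State (resolventGoal r cl G₁ G₂) (resolventStore r cl ss S)) τ →
    ⟦ M ⟧ (State (G₁ ++ user q ss ∷ G₂) S) τ
  resolvent⇒goal {G₁} {G₂} {q} {ss} {S} {cl} r cl∈P hpred≡q |hargs|≡|ss| {τ} (hG , hES) =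
    let (h₁ , hBG₂) = ⋀-++⁻ G₁ hG
        (hB , h₂)   = ⋀-++⁻ (renCs r (body cl)) hBG₂
        (hE , hS)   = ⋀ₚ-++⁻ (zipWith _≐_ ss (renTs r (hargs cl))) hES
    in ⋀-++⁺ G₁ h₁ (head-holds hB hE , h₂) , hS
    where
    head-holds : ⟦ M ⟧ (⋀ (renCs r (body cl))) τ → ⟦ zipWith _≐_ ss (renTs r (hargs cl)) ⟧ₚ τ →
                 ⟦ M ⟧ (userᶠ q ss) τ
    head-holds hB hE = Equivalence.from (M⊨P* q (evals M τ ss)) (¬¬-map instance-of-cl head-equations)
      where
      head-equations : ¬¬ (evals M τ ss ≡ evals M τ (renTs r (hargs cl)))
      head-equations =
        ⋀≐-elim ss _ (trans (sym |hargs|≡|ss|) (sym (length-renTs r (hargs cl)))) hE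

      instance-of-cl : evals M τ ss ≡ evals M τ (renTs r (hargs cl)) → ClauseInstance P q (evals M τ ss)
      instance-of-cl eq = cl , cl∈P , hpred≡q , τ ∘ r , trans (sym (evals-ren r (hargs cl))) (sym eq) ,
                          subst id (⋀-ren r (body cl) τ) hB

  mutual
    state⇒answers : ∀ {G S as ρ} → Tree CT P G S as → ⟦ M ⟧ (State G S) ρ →
                    ∃Agree (varsState CT P G S) ρ (AnyAnswer as)
    state⇒answers success (_ , hS) = ∃Agree-intro (λ _ → refl) (here hS)
    state⇒answers {ρ = ρ} (failure unsat) (_ , hS) = ⊥-elim (unsat M M⊨CT ρ hS)
    state⇒answers (solve {G₁} {G₂} {c} {S} t) (hG , hS) =
      let (h₁ , hc , h₂) = ⋀-++⁻ G₁ hG in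
      ∃Agree-map (varsState-solve G₁ G₂ c S) id (state⇒answers t (⋀-++⁺ G₁ h₁ h₂ , hc , hS))
    state⇒answers {ρ = ρ} (unfold {G₁} {q = q} {ss} branches) hState@(hG , _) =
      let (_ , hq , _) = ⋀-++⁻ G₁ hG in
      Equivalence.to (M⊨P* q (evals M ρ ss)) hq >>= branches⇒answers branches hState

    branches⇒answers : ∀ {G₁ G₂ q ss S cls as ρ} → Branches CT P G₁ G₂ q ss S cls as →
      ⟦ M ⟧ (State (G₁ ++ user q ss ∷ G₂) S) ρ → ClauseInstance cls q (evals M ρ ss) →
      ∃Agree (varsState CT P (G₁ ++ user q ss ∷ G₂) S) ρ (AnyAnswer as)
    branches⇒answers (skip mismatch _) _ (cl , here refl , hpred≡q , σ , σ⊨head , _) =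
      ⊥-elim (mismatch (hpred≡q , evals-≡⇒length-≡ (hargs cl) _ σ⊨head))
    branches⇒answers (skip _ rest) hState (cl , there cl∈ , inst) =
      branches⇒answers rest hState (cl , cl∈ , inst)
    branches⇒answers {G₁} {G₂} {q} {ss} {S} (step {cl = cl} r r-inj fresh _ |hargs|≡|ss| t _) hState
                     (_ , here refl , _ , σ , σ⊨head , σ⊨body) =
      ∃Agree-bind (varsState-unfold G₁ G₂ q ss S r cl |hargs|≡|ss|)
                  (goal⇒∃resolvent {G₁} {G₂} {q} {ss} {S} {cl} r r-inj fresh {σ = σ}
                                   hState σ⊨head σ⊨body)
                  (∃Agree-map id ++⁺ˡ ∘ state⇒answers t)
    branches⇒answers (step {a = a} _ _ _ _ _ _ rest) hState (cl , there cl∈ , inst) =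
      ∃Agree-map id (++⁺ʳ a) (branches⇒answers rest hState (cl , cl∈ , inst))

  mutual
    answer⇒state : ∀ {G S bs σ} → Tree CT P G S bs → AnyAnswer bs σ →
                   ∃Agree (varsState CT P G S) σ (⟦ M ⟧ (State G S))
    answer⇒state success (here hS) = ∃Agree-intro (λ _ → refl) (tt , hS)
    answer⇒state (solve {G₁} {G₂} {c} {S} t) hb =
      ∃Agree-map (varsState-solve G₁ G₂ c S) solved⇒state (answer⇒state t hb)
      where
      solved⇒state : ∀ {τ} → ⟦ M ⟧ (State (G₁ ++ G₂) (c ∷ S)) τ → ⟦ M ⟧ (State (G₁ ++ prim c ∷ G₂) S) τ
      solved⇒state (hG , hc , hS) = let (h₁ , h₂) = ⋀-++⁻ G₁ hG in ⋀-++⁺ G₁ h₁ (hc , h₂) , hS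
    answer⇒state (unfold branches) hb = answer∈branches⇒state branches id hb

    answer∈branches⇒state : ∀ {G₁ G₂ q ss S cls bs σ} → Branches CT P G₁ G₂ q ss S cls bs → cls ⊆ P →
      AnyAnswer bs σ →
      ∃Agree (varsState CT P (G₁ ++ user q ss ∷ G₂) S) σ (⟦ M ⟧ (State (G₁ ++ user q ss ∷ G₂) S))
    answer∈branches⇒state (skip _ rest) cls⊆P hb = answer∈branches⇒state rest (cls⊆P ∘ there) hb
    answer∈branches⇒state {G₁} {G₂} {q} {ss} {S}
                          (step {cl = cl} {a = a} r _ _ hpred≡q |hargs|≡|ss| t rest) cls⊆P hb
      with ++⁻ a hb
    ... | inj₁ ha  =
      ∃Agree-map (varsState-unfold G₁ G₂ q ss S r cl |hargs|≡|ss|)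
                 (resolvent⇒goal {G₁} {G₂} {q} {ss} {S} {cl} r (cls⊆P (here refl)) hpred≡q |hargs|≡|ss|)
                 (answer⇒state t ha)
    ... | inj₂ has = answer∈branches⇒state rest (cls⊆P ∘ there) has

  ∃₋answers⇒∃₋goal : ∀ {C₁ C₂ bs ρ} → Tree CT P (C₁ ++ C₂) [] bs → ⟦ M ⟧ (∃₋ (varsCs C₁) (⋁ bs)) ρ →
                     ∃Agree (varsCs C₁) ρ (⟦ M ⟧ (⋀ C₂))
  ∃₋answers⇒∃₋goal {C₁} {C₂} {bs} tree h =
    ∃Agree-map id (proj₂ ∘ ⋀-++⁻ C₁ ∘ proj₁)
      (∃Agree-bind C₁⊆ (∃₋-elim (varsCs C₁) (⋁ bs) h) (λ hb → ⋁-elim bs hb >>= answer⇒state tree))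
    where
    C₁⊆ : varsCs C₁ ⊆ varsCs (C₁ ++ C₂) ++ []
    C₁⊆ y∈ = ∈-++⁺ˡ (subst (_ ∈_) (sym (varsCs-++ C₁ C₂)) (∈-++⁺ˡ y∈))

mainTheorem1 : {F Pr Q : Set}
    (CT : Formula F Pr Q → Set) (P : List (Clause F Pr Q))
    (C₁ C₂ : List (Constraint F Pr Q))
    (as bs : List (List (Prim F Pr))) →
    Tree CT P C₁ [] as →
    Tree CT P (C₁ ++ C₂) [] bs →
    Entails CT P (¬ᶠ ∃₋ (varsCs C₁) (⋁ as ∧ᶠ ¬ᶠ ∃₋ (varsCs C₁) (⋁ bs))) →
    ValidRule CT P C₁ C₂
mainTheorem1 CT P C₁ C₂ as bs treeA treeB hyp M M⊨CT M⊨P* ρ (hC₁ , ¬∃₋C₂) =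
  ∃Agree-map (xs⊆xs++ys V []) id (state⇒answers treeA (hC₁ , tt)) λ (ρ′ , ρ≈ρ′ , ha) →
    hyp M M⊨CT M⊨P* ρ (∃₋-intro V _ ρ≈ρ′ (⋁-intro ha , ¬∃₋answers ρ≈ρ′))
  where
  open Semantics M
  open Computation CT P M M⊨CT M⊨P*
  V = varsCs C₁

  ¬∃₋answers : ∀ {ρ′} → Agree V ρ ρ′ → ¬ ⟦ M ⟧ (∃₋ V (⋁ bs)) ρ′
  ¬∃₋answers ρ≈ρ′ h = ∃₋answers⇒∃₋goal {C₁} {C₂} treeB h λ (τ , ρ′≈τ , hC₂) →
    ¬∃₋C₂ (∃₋-intro V (⋀ C₂) (λ y∈ → trans (ρ≈ρ′ y∈) (ρ′≈τ y∈)) hC₂)
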